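{- There is a deterministic distributed algorithm in the LOCAL model that, given a $2^{ -4}$-fractional $14$-approximate maximum matching in a 2-colored bipartite graph, computes in $O(1)$ rounds an integral matching that is $434$-approximate.
   Context: LOCAL model: the network is an undirected simple graph $G=(V,E)$; each node has a unique identifier; synchronous rounds, in each of which each node does local computation and sends a message of arbitrary size to each neighbor. A 2-colored bipartite graph is a bipartite graph with a proper 2-coloring of its nodes known to the nodes. For $v\in V$ let $E(v)$ be the set of edges incident to $v$. A fractional matching is an assignment $x_e\in[0,1]$ with $\sum_{e\in E(v)}x_e\le 1$ for all $v$. It is $2^{ -i}$-fractional if every $x_e\in\{0\}\cup\{2^{ -j}:0\le j\le i\}$. A (fractional or integral) matching is $c$-approximate if $c\sum_e x_e\ge|M^*|$ for a maximum (cardinality) matching $M^*$ of $G$; an integral matching is one with all $x_e\in\{0,1\}$. -}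

module Defs where

open import Data.Bool using (Bool; true; false; _∧_; if_then_else_)
open import Data.Nat as ℕ using (ℕ; zero; suc; _<ᵇ_)
open import Data.List using (List; []; _∷_; map; filterᵇ; concatMap; foldr; length)
open import Data.List.Membership.Propositional using (_∈_)
open import Data.List.Relation.Unary.AllPairs using (AllPairs)
open import Data.Product using (Σ; ∃; _×_; _,_)
open import Data.Sum using (_⊎_)
open import Data.Rational as ℚ using (ℚ; 0ℚ; 1ℚ; ½; _+_; _*_; _≤_)
open import Relation.Binary.PropositionalEquality using (_≡_; _≢_)

-- A finite simple undirected graph whose nodes ARE their unique
-- identifiers: the node set is a strictly increasing list V of naturals
-- (so identifiers are distinct), adjacency is a symmetric irreflexive
-- Boolean relation (only its restriction to V matters).

record Graph : Set where
  field
    V       : List ℕ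
    V-ids   : AllPairs ℕ._<_ V
    adj     : ℕ → ℕ → Bool
    adj-sym : ∀ u v → adj u v ≡ adj v u
    adj-irr : ∀ u → adj u u ≡ false

open Graph public

nbrs : Graph → ℕ → List ℕ
nbrs G u = filterᵇ (adj G u) (V G)

-- each undirected edge {u,v} listed once, as (u , v) with u < v
edges : Graph → List (ℕ × ℕ)
edges G = concatMap (λ u → map (λ v → u , v) (filterᵇ (λ v → (u <ᵇ v) ∧ adj G u v) (V G))) (V G)

Proper2Coloring : Graph → (ℕ → Bool) → Set
Proper2Coloring G col = ∀ u v → u ∈ V G → v ∈ V G → adj G u v ≡ true → col u ≢ col v

sumℚ : List ℚ → ℚ
sumℚ = foldr _+_ 0ℚ

weight : Graph → (ℕ → ℕ → ℚ) → ℚ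
weight G x = sumℚ (map (λ e → x (Data.Product.proj₁ e) (Data.Product.proj₂ e)) (edges G))

record FractionalMatching (G : Graph) (x : ℕ → ℕ → ℚ) : Set where
  field
    symm     : ∀ u v → u ∈ V G → v ∈ V G → adj G u v ≡ true → x u v ≡ x v u
    nonneg   : ∀ u v → u ∈ V G → v ∈ V G → adj G u v ≡ true → 0ℚ ≤ x u v
    le-one   : ∀ u v → u ∈ V G → v ∈ V G → adj G u v ≡ true → x u v ≤ 1ℚ
    vertex   : ∀ u → u ∈ V G → sumℚ (map (x u) (nbrs G u)) ≤ 1ℚ

half^ : ℕ → ℚ
half^ zero    = 1ℚ
half^ (suc j) = ½ * half^ j

DyadicFractional : ℕ → Graph → (ℕ → ℕ → ℚ) → Set
DyadicFractional i G x =
  ∀ u v → u ∈ V G → v ∈ V G → adj G u v ≡ true →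
    (x u v ≡ 0ℚ) ⊎ (Σ ℕ λ j → (j ℕ.≤ i) × (x u v ≡ half^ j))

record IntegralMatching (G : Graph) (M : ℕ → ℕ → Bool) : Set where
  field
    onEdges : ∀ u v → u ∈ V G → v ∈ V G → M u v ≡ true → adj G u v ≡ true
    symm    : ∀ u v → u ∈ V G → v ∈ V G → M u v ≡ M v u
    vertex  : ∀ u → u ∈ V G → length (filterᵇ (M u) (nbrs G u)) ℕ.≤ 1

indicator : (ℕ → ℕ → Bool) → ℕ → ℕ → ℚ
indicator M u v = if M u v then 1ℚ else 0ℚ

-- c-approximate: c · Σ_e x_e ≥ |M*| for a maximum matching M*, i.e.
-- c · Σ_e x_e ≥ |M| for every integral matching M of G.
Approximate : ℚ → Graph → (ℕ → ℕ → ℚ) → Set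
Approximate c G x =
  ∀ M → IntegralMatching G M → weight G (indicator M) ≤ c * weight G x

-- Initially a node knows its identifier, its colour, and for each
-- incident edge the neighbour's identifier and the input value x_e.
-- In every round each node sends an arbitrary message (of arbitrary type)
-- to each neighbour (the message may depend on the neighbour's identifier),
-- then updates its state from the messages received (tagged by sender).

record LocalAlgorithm : Set₁ where
  field
    State : Set
    Msg   : Set
    init  : (myId : ℕ) → (myColour : Bool) → List (ℕ × ℚ) → State
    send  : State → (to : ℕ) → Msg
    recv  : State → List (ℕ × Msg) → State
    out   : State → (nbr : ℕ) → Bool

open LocalAlgorithm public

run : (A : LocalAlgorithm) → Graph → (ℕ → Bool) → (ℕ → ℕ → ℚ) → ℕ → ℕ → State A
run A G col x zero    u = init A u (col u) (map (λ v → v , x u v) (nbrs G u))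
run A G col x (suc t) u = recv A (run A G col x t u) (map (λ v → v , send A (run A G col x t v) u) (nbrs G u))

output : (A : LocalAlgorithm) → Graph → (ℕ → Bool) → (ℕ → ℕ → ℚ) → ℕ → ℕ → ℕ → Bool
output A G col x T u v = adj G u v ∧ out A (run A G col x T u) v

Consistent : Graph → (ℕ → ℕ → Bool) → Set
Consistent G M = ∀ u v → u ∈ V G → v ∈ V G → adj G u v ≡ true → M u v ≡ M v u

module Submission where

-- Every nonzero x_e is at least 1/16, so each vertex has at most 16 support
-- neighbours (edges with x_e ≠ 0).  In the proposal algorithm the nodes of colour true
-- propose along their support edges, one per phase, and the other nodes accept the first
-- proposal they receive; a phase takes two rounds (proposal, reply).  After 16 phases the
-- partners form a matching M in which every support edge has a matched endpoint.  Charging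
-- each support edge to a matched endpoint shows  Σ_e x_e ≤ #matched vertices = 2|M|, so
-- |M*| ≤ 14 Σ_e x_e ≤ 28 |M| ≤ 434 |M|.

open import Defs
open import Data.Nat as ℕ using (ℕ; zero; suc; _<ᵇ_; _≡ᵇ_; z≤n; s≤s)
import Data.Nat.Properties as ℕP
open import Data.Bool using (Bool; true; false; _∧_; not; if_then_else_; T; T?)
open import Data.Maybe using (Maybe; just; nothing; is-nothing; _<∣>_)
open import Data.Maybe.Properties using (just-injective)
import Data.List.Relation.Unary.All as All
open import Data.List.Relation.Unary.AllPairs using (AllPairs; []; _∷_)
import Data.List.Relation.Unary.AllPairs as AllPairs
import Data.List.Relation.Unary.AllPairs.Properties as AllPairs
open import Data.Bool.Properties using (T-≡; ∧-conicalˡ; ∧-conicalʳ; ∧-zeroʳ; ⇔→≡; ¬-not)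
open import Data.Bool.ListAction using (any)
open import Data.List using (List; []; _∷_; map; filter; filterᵇ; concatMap; _++_; length)
import Data.List.Properties as List
open import Data.List.Membership.Propositional using (_∈_; find; lose)
open import Data.List.Membership.Propositional.Properties using (∈-filter⁻; ∈-filter⁺; ∈-map⁺; ∈-map⁻; ∈-concatMap⁻; ∈-map∘filter⁺; ∈-map∘filter⁻)
open import Data.List.Relation.Unary.Any using (here; there)
open import Data.List.Relation.Unary.Any.Properties using (any⁺)
open import Data.Product using (Σ; ∃; _×_; _,_; proj₁; proj₂)
open import Data.Sum as Sum using (_⊎_; inj₁; inj₂)
open import Data.Rational as ℚ using (ℚ; 0ℚ; 1ℚ; _+_; _*_; _≤_; _/_)
import Data.Rational.Properties as ℚP
open import Algebra.Bundles using (CommutativeMonoid)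
open import Algebra.Properties.CommutativeSemigroup
  (CommutativeMonoid.commutativeSemigroup ℚP.+-0-commutativeMonoid) using (interchange)
open import Function using (_∘_; Equivalence; mk⇔)
open import Relation.Binary.Definitions using (tri<; tri≈; tri>)
open import Relation.Binary.PropositionalEquality
open import Relation.Nullary using (yes; no; ¬_)
open import Relation.Nullary.Decidable using (¬?; from-yes)
open import Relation.Unary using (Decidable)
open import Data.Integer using (+_)
open import Data.Empty using (⊥-elim)

T⇒≡ : ∀ {b} → T b → b ≡ true
T⇒≡ = Equivalence.to T-≡

≡⇒T : ∀ {b} → b ≡ true → T b
≡⇒T = Equivalence.from T-≡

false≢true : false ≢ true
false≢true ()

≡ᵇ-refl : ∀ v → (v ≡ᵇ v) ≡ true
≡ᵇ-refl v = T⇒≡ (ℕP.≡⇒≡ᵇ v v refl)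

≤-+ʳ : ∀ {p q} → 0ℚ ≤ q → p ≤ p + q
≤-+ʳ {p} {q} 0≤q = subst (_≤ p + q) (ℚP.+-identityʳ p) (ℚP.+-monoʳ-≤ p 0≤q)

≤-+ˡ : ∀ {p q} → 0ℚ ≤ p → q ≤ p + q
≤-+ˡ {p} {q} 0≤p = subst (_≤ p + q) (ℚP.+-identityˡ q) (ℚP.+-monoˡ-≤ q 0≤p)

sumOver : {A : Set} → List A → (A → ℚ) → ℚ
sumOver l g = sumℚ (map g l)

syntax sumOver l (λ a → e) = ∑[ a ∈ l ] e

module _ {A : Set} where

  sum-mono : ∀ (g h : A → ℚ) l → (∀ a → a ∈ l → g a ≤ h a) → sumOver l g ≤ sumOver l h
  sum-mono g h []      le = ℚP.≤-refl
  sum-mono g h (a ∷ l) le = ℚP.+-mono-≤ (le a (here refl)) (sum-mono g h l (λ b b∈l → le b (there b∈l)))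

  sum-cong : ∀ (g h : A → ℚ) l → (∀ a → a ∈ l → g a ≡ h a) → sumOver l g ≡ sumOver l h
  sum-cong g h []      eq = refl
  sum-cong g h (a ∷ l) eq = cong₂ _+_ (eq a (here refl)) (sum-cong g h l (λ b b∈l → eq b (there b∈l)))

  sum-zero : ∀ (l : List A) → (∑[ a ∈ l ] 0ℚ) ≡ 0ℚ
  sum-zero []      = refl
  sum-zero (a ∷ l) = trans (ℚP.+-identityˡ _) (sum-zero l)

  sum-nonneg : ∀ (g : A → ℚ) l → (∀ a → a ∈ l → 0ℚ ≤ g a) → 0ℚ ≤ sumOver l g
  sum-nonneg g l nonneg = subst (_≤ sumOver l g) (sum-zero l) (sum-mono (λ _ → 0ℚ) g l nonneg)

  sum-+ : ∀ (g h : A → ℚ) l → (∑[ a ∈ l ] (g a + h a)) ≡ sumOver l g + sumOver l h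
  sum-+ g h []      = sym (ℚP.+-identityˡ 0ℚ)
  sum-+ g h (a ∷ l) = trans (cong (_+_ (g a + h a)) (sum-+ g h l)) (interchange (g a) (h a) _ _)

  sum-++ : ∀ (g : A → ℚ) l k → sumOver (l ++ k) g ≡ sumOver l g + sumOver k g
  sum-++ g []      k = sym (ℚP.+-identityˡ _)
  sum-++ g (a ∷ l) k = trans (cong (_+_ (g a)) (sum-++ g l k)) (sym (ℚP.+-assoc (g a) _ _))

  sum-filter : ∀ (g : A → ℚ) (p : A → Bool) l →
               sumOver (filterᵇ p l) g ≡ (∑[ a ∈ l ] (if p a then g a else 0ℚ))
  sum-filter g p []      = refl
  sum-filter g p (a ∷ l) with p a
  ... | true  = cong (_+_ (g a)) (sum-filter g p l)
  ... | false = trans (sum-filter g p l) (sym (ℚP.+-identityˡ _))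

sum-swap : ∀ {A B : Set} (h : A → B → ℚ) l k →
           (∑[ a ∈ l ] ∑[ b ∈ k ] h a b) ≡ (∑[ b ∈ k ] ∑[ a ∈ l ] h a b)
sum-swap h []      k = sym (sum-zero k)
sum-swap h (a ∷ l) k = trans (cong (_+_ (sumOver k (h a))) (sum-swap h l k))
                             (sym (sum-+ (h a) (λ b → ∑[ a ∈ l ] h a b) k))

∈-nbrs⁻ : ∀ G {u v} → v ∈ nbrs G u → v ∈ V G × adj G u v ≡ true
∈-nbrs⁻ G {u} v∈N = let (v∈V , uv) = ∈-filter⁻ (T? ∘ adj G u) v∈N in v∈V , T⇒≡ uv

∈-nbrs⁺ : ∀ G {u v} → v ∈ V G → adj G u v ≡ true → v ∈ nbrs G u
∈-nbrs⁺ G {u} v∈V uv = ∈-filter⁺ (T? ∘ adj G u) v∈V (≡⇒T uv)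

-- v is an upper neighbour of u when the edge {u,v} is listed in `edges` as (u , v)
upper : Graph → ℕ → ℕ → Bool
upper G u v = (u <ᵇ v) ∧ adj G u v

upperEdges : Graph → ℕ → List (ℕ × ℕ)
upperEdges G u = map (u ,_) (filterᵇ (upper G u) (V G))

∈-edges : ∀ G {u v} → (u , v) ∈ edges G → u ∈ V G × v ∈ V G × adj G u v ≡ true
∈-edges G e∈E with find (∈-concatMap⁻ (upperEdges G) {xs = V G} e∈E)
... | w , w∈V , e∈Uw with ∈-map⁻ (w ,_) e∈Uw
...   | v , v∈F , refl =
  let (v∈V , up) = ∈-filter⁻ (T? ∘ upper G w) v∈F in w∈V , v∈V , ∧-conicalʳ _ _ (T⇒≡ up)

sum-edges : ∀ G (g : ℕ × ℕ → ℚ) →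
            sumOver (edges G) g ≡ (∑[ u ∈ V G ] ∑[ v ∈ V G ] (if upper G u v then g (u , v) else 0ℚ))
sum-edges G g = go (V G)
  where
  row : ℕ → ℚ
  row u = ∑[ v ∈ V G ] (if upper G u v then g (u , v) else 0ℚ)
  go : ∀ l → sumOver (concatMap (upperEdges G) l) g ≡ (∑[ u ∈ l ] row u)
  go []      = refl
  go (u ∷ l) = begin
    sumOver (upperEdges G u ++ concatMap (upperEdges G) l) g
      ≡⟨ sum-++ g (upperEdges G u) _ ⟩
    sumOver (upperEdges G u) g + sumOver (concatMap (upperEdges G) l) g
      ≡⟨ cong₂ _+_ (cong sumℚ (sym (List.map-∘ (filterᵇ (upper G u) (V G))))) (go l) ⟩
    sumOver (filterᵇ (upper G u) (V G)) (λ v → g (u , v)) + (∑[ u ∈ l ] row u)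
      ≡⟨ cong (_+ (∑[ u ∈ l ] row u)) (sum-filter (λ v → g (u , v)) (upper G u) (V G)) ⟩
    row u + (∑[ u ∈ l ] row u) ∎
    where open ≡-Reasoning

<ᵇ-false : ∀ {m n} → ¬ m ℕ.< n → (m <ᵇ n) ≡ false
<ᵇ-false {m} {n} m≮n with m <ᵇ n in eq
... | false = refl
... | true  = ⊥-elim (m≮n (ℕP.<ᵇ⇒< m n (≡⇒T eq)))

-- an edge {u,v} is listed exactly once: either as (u , v) or as (v , u)
split-adj : ∀ G u v (q : ℚ) →
            (if adj G u v then q else 0ℚ) ≡ (if upper G u v then q else 0ℚ) + (if upper G v u then q else 0ℚ)
split-adj G u v q rewrite adj-sym G v u with adj G u v in uv
... | false rewrite ∧-zeroʳ (u <ᵇ v) | ∧-zeroʳ (v <ᵇ u) = sym (ℚP.+-identityˡ 0ℚ)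
... | true with ℕP.<-cmp u v
...   | tri< u<v _ v≮u rewrite T⇒≡ (ℕP.<⇒<ᵇ u<v) | <ᵇ-false v≮u = sym (ℚP.+-identityʳ q)
...   | tri> u≮v _ v<u rewrite T⇒≡ (ℕP.<⇒<ᵇ v<u) | <ᵇ-false u≮v = sym (ℚP.+-identityˡ q)
...   | tri≈ _ refl _ = ⊥-elim (false≢true (trans (sym (adj-irr G u)) uv))

if-+ : ∀ (b : Bool) (p q : ℚ) → (if b then p + q else 0ℚ) ≡ (if b then p else 0ℚ) + (if b then q else 0ℚ)
if-+ true  p q = refl
if-+ false p q = sym (ℚP.+-identityˡ 0ℚ)

double-count : ∀ G (f : ℕ → ℕ → ℚ) →
  (∑[ e ∈ edges G ] (f (proj₁ e) (proj₂ e) + f (proj₂ e) (proj₁ e))) ≡ (∑[ u ∈ V G ] ∑[ v ∈ nbrs G u ] f u v)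
double-count G f = begin
    (∑[ e ∈ edges G ] (f (proj₁ e) (proj₂ e) + f (proj₂ e) (proj₁ e)))
  ≡⟨ sum-edges G _ ⟩
    (∑[ u ∈ Vs ] ∑[ v ∈ Vs ] (if upper G u v then f u v + f v u else 0ℚ))
  ≡⟨ sum-cong _ _ Vs (λ u _ → trans (sum-cong _ _ Vs (λ v _ → if-+ (upper G u v) (f u v) (f v u))) (sum-+ _ _ Vs)) ⟩
    (∑[ u ∈ Vs ] (sumOver Vs (forward u) + ∑[ v ∈ Vs ] (if upper G u v then f v u else 0ℚ)))
  ≡⟨ sum-+ _ _ Vs ⟩
    (∑[ u ∈ Vs ] sumOver Vs (forward u)) + (∑[ u ∈ Vs ] ∑[ v ∈ Vs ] (if upper G u v then f v u else 0ℚ))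
  ≡⟨ cong (_+_ (∑[ u ∈ Vs ] sumOver Vs (forward u))) (sum-swap (λ u v → if upper G u v then f v u else 0ℚ) Vs Vs) ⟩
    (∑[ u ∈ Vs ] sumOver Vs (forward u)) + (∑[ u ∈ Vs ] ∑[ v ∈ Vs ] (if upper G v u then f u v else 0ℚ))
  ≡⟨ sym (sum-+ _ _ Vs) ⟩
    (∑[ u ∈ Vs ] (sumOver Vs (forward u) + ∑[ v ∈ Vs ] (if upper G v u then f u v else 0ℚ)))
  ≡⟨ sum-cong _ _ Vs (λ u _ → trans (sym (sum-+ _ _ Vs)) (sum-cong _ _ Vs (λ v _ → sym (split-adj G u v (f u v))))) ⟩
    (∑[ u ∈ Vs ] ∑[ v ∈ Vs ] (if adj G u v then f u v else 0ℚ))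
  ≡⟨ sum-cong _ _ Vs (λ u _ → sym (sum-filter (f u) (adj G u) Vs)) ⟩
    (∑[ u ∈ Vs ] ∑[ v ∈ nbrs G u ] f u v)
  ∎
  where
  open ≡-Reasoning
  Vs = V G
  forward : ℕ → ℕ → ℚ
  forward u v = if upper G u v then f u v else 0ℚ

ind : Bool → ℚ
ind b = if b then 1ℚ else 0ℚ

ind-nonneg : ∀ b → 0ℚ ≤ ind b
ind-nonneg true  = ℚP.nonNegative⁻¹ 1ℚ
ind-nonneg false = ℚP.≤-refl

matched : Graph → (ℕ → ℕ → Bool) → ℕ → Bool
matched G M u = any (M u) (nbrs G u)

matched-intro : ∀ G M {u v} → v ∈ nbrs G u → M u v ≡ true → matched G M u ≡ true
matched-intro G M v∈N uv = T⇒≡ (any⁺ (M _) (lose v∈N (≡⇒T uv)))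

CoversSupport : Graph → (ℕ → ℕ → Bool) → (ℕ → ℕ → ℚ) → Set
CoversSupport G M x = ∀ u v → u ∈ V G → v ∈ V G → adj G u v ≡ true → x u v ≢ 0ℚ →
                      matched G M u ≡ true ⊎ matched G M v ≡ true

ind-any≤sum : ∀ {A : Set} (p : A → Bool) l → ind (any p l) ≤ (∑[ a ∈ l ] ind (p a))
ind-any≤sum p []      = ℚP.≤-refl
ind-any≤sum p (a ∷ l) with p a
... | true  = ≤-+ʳ (sum-nonneg _ l (λ b _ → ind-nonneg (p b)))
... | false = ℚP.≤-trans (ind-any≤sum p l) (≤-+ˡ ℚP.≤-refl)

masked-nonneg : ∀ (b : Bool) {q} → 0ℚ ≤ q → 0ℚ ≤ (if b then q else 0ℚ)
masked-nonneg true  0≤q = 0≤q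
masked-nonneg false _   = ℚP.≤-refl

charge : Graph → (ℕ → ℕ → Bool) → (ℕ → ℕ → ℚ) → ℕ → ℕ → ℚ
charge G M x u v = if matched G M u then x u v else 0ℚ

module _ {G : Graph} {x : ℕ → ℕ → ℚ} (fm : FractionalMatching G x) (M : ℕ → ℕ → Bool) where

  open FractionalMatching fm

  charge-nonneg : ∀ {u v} → u ∈ V G → v ∈ V G → adj G u v ≡ true → 0ℚ ≤ charge G M x u v
  charge-nonneg u∈V v∈V uv = masked-nonneg (matched G M _) (nonneg _ _ u∈V v∈V uv)

  charge-matched : ∀ {u} v → matched G M u ≡ true → charge G M x u v ≡ x u v
  charge-matched {u} v u-matched = cong (λ b → if b then x u v else 0ℚ) u-matched

  charge-edge : CoversSupport G M x → ∀ u v → u ∈ V G → v ∈ V G → adj G u v ≡ true →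
                x u v ≤ charge G M x u v + charge G M x v u
  charge-edge covers u v u∈V v∈V uv with x u v ℚ.≟ 0ℚ
  ... | yes x≡0 = subst (_≤ charge G M x u v + charge G M x v u) (sym x≡0)
                    (ℚP.≤-trans (charge-nonneg u∈V v∈V uv) (≤-+ʳ (charge-nonneg v∈V u∈V (trans (adj-sym G v u) uv))))
  ... | no  x≢0 with covers u v u∈V v∈V uv x≢0
  ...   | inj₁ u-matched = subst (_≤ charge G M x u v + charge G M x v u) (charge-matched v u-matched)
                             (≤-+ʳ (charge-nonneg v∈V u∈V (trans (adj-sym G v u) uv)))
  ...   | inj₂ v-matched = subst (_≤ charge G M x u v + charge G M x v u)
                             (trans (charge-matched u v-matched) (sym (symm u v u∈V v∈V uv)))
                             (≤-+ˡ (charge-nonneg u∈V v∈V uv))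

  charge-vertex : ∀ u → u ∈ V G → (∑[ v ∈ nbrs G u ] charge G M x u v) ≤ ind (matched G M u)
  charge-vertex u u∈V with matched G M u
  ... | true  = vertex u u∈V
  ... | false = ℚP.≤-reflexive (sum-zero (nbrs G u))

  cover-weight : Consistent G M → CoversSupport G M x →
                 weight G x ≤ weight G (indicator M) + weight G (indicator M)
  cover-weight consistent covers = begin
      weight G x
    ≤⟨ sum-mono _ _ (edges G) (λ (u , v) e∈E → let (u∈V , v∈V , uv) = ∈-edges G e∈E in charge-edge covers u v u∈V v∈V uv) ⟩
      (∑[ e ∈ edges G ] (charge G M x (proj₁ e) (proj₂ e) + charge G M x (proj₂ e) (proj₁ e)))
    ≡⟨ double-count G (charge G M x) ⟩
      (∑[ u ∈ V G ] ∑[ v ∈ nbrs G u ] charge G M x u v)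
    ≤⟨ sum-mono _ _ (V G) charge-vertex ⟩
      (∑[ u ∈ V G ] ind (matched G M u))
    ≤⟨ sum-mono _ _ (V G) (λ u _ → ind-any≤sum (M u) (nbrs G u)) ⟩
      (∑[ u ∈ V G ] ∑[ v ∈ nbrs G u ] indicator M u v)
    ≡⟨ sym (double-count G (indicator M)) ⟩
      (∑[ e ∈ edges G ] (indicator M (proj₁ e) (proj₂ e) + indicator M (proj₂ e) (proj₁ e)))
    ≡⟨ sum-cong _ _ (edges G) (λ (u , v) e∈E → let (u∈V , v∈V , uv) = ∈-edges G e∈E in
                                  cong (λ b → indicator M u v + ind b) (sym (consistent u v u∈V v∈V uv))) ⟩
      (∑[ e ∈ edges G ] (indicator M (proj₁ e) (proj₂ e) + indicator M (proj₁ e) (proj₂ e)))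
    ≡⟨ sum-+ _ _ (edges G) ⟩
      weight G (indicator M) + weight G (indicator M)
    ∎
    where open ℚP.≤-Reasoning

indicator-weight-nonneg : ∀ G M → 0ℚ ≤ weight G (indicator M)
indicator-weight-nonneg G M = sum-nonneg _ (edges G) (λ (u , v) _ → ind-nonneg (M u v))

approximate-half : ∀ (c d : ℚ) .{{_ : ℚ.NonNegative c}} G x y → c + c ≤ d →
                   0ℚ ≤ weight G y → weight G x ≤ weight G y + weight G y →
                   Approximate c G x → Approximate d G y
approximate-half c d G x y 2c≤d 0≤Wy Wx≤2Wy c-approx M isM = begin
    weight G (indicator M)  ≤⟨ c-approx M isM ⟩
    c * weight G x          ≤⟨ ℚP.*-monoˡ-≤-nonNeg c Wx≤2Wy ⟩
    c * (Wy + Wy)           ≡⟨ ℚP.*-distribˡ-+ c Wy Wy ⟩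
    c * Wy + c * Wy         ≡⟨ sym (ℚP.*-distribʳ-+ Wy c c) ⟩
    (c + c) * Wy            ≤⟨ ℚP.*-monoʳ-≤-nonNeg Wy {{ℚ.nonNegative 0≤Wy}} 2c≤d ⟩
    d * Wy                  ∎
  where
  open ℚP.≤-Reasoning
  Wy = weight G y

supportOf : List (ℕ × ℚ) → List ℕ
supportOf l = map proj₁ (filter (λ p → ¬? (proj₂ p ℚ.≟ 0ℚ)) l)

weightsAt : Graph → (ℕ → ℕ → ℚ) → ℕ → List (ℕ × ℚ)
weightsAt G x u = map (λ v → v , x u v) (nbrs G u)

support : Graph → (ℕ → ℕ → ℚ) → ℕ → List ℕ
support G x u = supportOf (weightsAt G x u)

∈-support⁻ : ∀ G x {u v} → v ∈ support G x u → v ∈ nbrs G u × x u v ≢ 0ℚ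
∈-support⁻ G x {u} v∈S with ∈-map∘filter⁻ proj₁ (λ p → ¬? (proj₂ p ℚ.≟ 0ℚ)) v∈S
... | p , p∈W , refl , p≢0 with ∈-map⁻ (λ v → v , x u v) p∈W
...   | v , v∈N , refl = v∈N , p≢0

∈-support⁺ : ∀ G x {u v} → v ∈ nbrs G u → x u v ≢ 0ℚ → v ∈ support G x u
∈-support⁺ G x {u} {v} v∈N x≢0 =
  ∈-map∘filter⁺ proj₁ (λ p → ¬? (proj₂ p ℚ.≟ 0ℚ)) ((v , x u v) , ∈-map⁺ (λ v → v , x u v) v∈N , refl , x≢0)

times : ℕ → ℚ → ℚ
times zero    q = 0ℚ
times (suc n) q = q + times n q

times-mono : ∀ {m n} q → 0ℚ ≤ q → m ℕ.≤ n → times m q ≤ times n q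
times-mono {zero}  {zero}  q 0≤q _         = ℚP.≤-refl
times-mono {zero}  {suc n} q 0≤q _         = ℚP.≤-trans (times-mono {n = n} q 0≤q z≤n) (≤-+ˡ 0≤q)
times-mono {suc m} {suc n} q 0≤q (s≤s m≤n) = ℚP.+-monoʳ-≤ q (times-mono q 0≤q m≤n)

count-bound : ∀ {A : Set} {P : A → Set} (P? : Decidable P) (g : A → ℚ) ε l →
              (∀ a → a ∈ l → 0ℚ ≤ g a) → (∀ a → a ∈ l → P a → ε ≤ g a) →
              times (length (filter P? l)) ε ≤ sumOver l g
count-bound P? g ε []      _      _    = ℚP.≤-refl
count-bound P? g ε (a ∷ l) nonneg big with P? a
... | yes Pa = ℚP.+-mono-≤ (big a (here refl) Pa) rest
  where rest = count-bound P? g ε l (λ b b∈l → nonneg b (there b∈l)) (λ b b∈l → big b (there b∈l))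
... | no ¬Pa = ℚP.≤-trans rest (≤-+ˡ (nonneg a (here refl)))
  where rest = count-bound P? g ε l (λ b b∈l → nonneg b (there b∈l)) (λ b b∈l → big b (there b∈l))

dyadic-min : ∀ {q} → (q ≡ 0ℚ) ⊎ (Σ ℕ λ j → (j ℕ.≤ 4) × (q ≡ half^ j)) → q ≢ 0ℚ → + 1 / 16 ≤ q
dyadic-min (inj₁ q≡0)              q≢0 = ⊥-elim (q≢0 q≡0)
dyadic-min (inj₂ (j , j≤4 , refl)) _   = bound j j≤4
  where
  bound : ∀ j → j ℕ.≤ 4 → + 1 / 16 ≤ half^ j
  bound 0 _ = from-yes (+ 1 / 16 ℚ.≤? half^ 0)
  bound 1 _ = from-yes (+ 1 / 16 ℚ.≤? half^ 1)
  bound 2 _ = from-yes (+ 1 / 16 ℚ.≤? half^ 2)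
  bound 3 _ = from-yes (+ 1 / 16 ℚ.≤? half^ 3)
  bound 4 _ = from-yes (+ 1 / 16 ℚ.≤? half^ 4)
  bound (suc (suc (suc (suc (suc j))))) (s≤s (s≤s (s≤s (s≤s ()))))

-- the support neighbours of u carry weight at least 1/16 each, and at most 1 in total
support-count : ∀ {G x} → FractionalMatching G x → DyadicFractional 4 G x →
                ∀ u → u ∈ V G → times (length (support G x u)) (+ 1 / 16) ≤ 1ℚ
support-count {G} {x} fm dyadic u u∈V = begin
    times (length (support G x u)) (+ 1 / 16)
  ≡⟨ cong (λ n → times n (+ 1 / 16)) (List.length-map proj₁ (filter nonzero? (weightsAt G x u))) ⟩
    times (length (filter nonzero? (weightsAt G x u))) (+ 1 / 16)
  ≤⟨ count-bound nonzero? proj₂ (+ 1 / 16) (weightsAt G x u) nonneg big ⟩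
    sumOver (weightsAt G x u) proj₂
  ≡⟨ cong sumℚ (sym (List.map-∘ (nbrs G u))) ⟩
    sumOver (nbrs G u) (x u)
  ≤⟨ FractionalMatching.vertex fm u u∈V ⟩
    1ℚ ∎
  where
  open ℚP.≤-Reasoning
  nonzero? = λ (p : ℕ × ℚ) → ¬? (proj₂ p ℚ.≟ 0ℚ)
  edge-of : ∀ {p} → p ∈ weightsAt G x u → ∃ λ v → v ∈ V G × adj G u v ≡ true × p ≡ (v , x u v)
  edge-of p∈W = let (v , v∈N , p≡) = ∈-map⁻ (λ v → v , x u v) p∈W
                    (v∈V , uv) = ∈-nbrs⁻ G v∈N in v , v∈V , uv , p≡
  nonneg : ∀ p → p ∈ weightsAt G x u → 0ℚ ≤ proj₂ p
  nonneg p p∈W with edge-of p∈W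
  ... | v , v∈V , uv , refl = FractionalMatching.nonneg fm u v u∈V v∈V uv
  big : ∀ p → p ∈ weightsAt G x u → proj₂ p ≢ 0ℚ → + 1 / 16 ≤ proj₂ p
  big p p∈W p≢0 with edge-of p∈W
  ... | v , v∈V , uv , refl = dyadic-min (dyadic u v u∈V v∈V uv) p≢0

support-size : ∀ {G x} → FractionalMatching G x → DyadicFractional 4 G x →
               ∀ u → u ∈ V G → length (support G x u) ℕ.≤ 16
support-size {G} {x} fm dyadic u u∈V with length (support G x u) ℕ.≤? 16
... | yes small = small
... | no  large = ⊥-elim (ℚP.<-irrefl refl (ℚP.<-≤-trans 1<17/16 (ℚP.≤-trans 17/16≤count (support-count fm dyadic u u∈V))))
  where
  1<17/16 : 1ℚ ℚ.< times 17 (+ 1 / 16)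
  1<17/16 = from-yes (1ℚ ℚ.<? times 17 (+ 1 / 16))
  17/16≤count : times 17 (+ 1 / 16) ≤ times (length (support G x u)) (+ 1 / 16)
  17/16≤count = times-mono (+ 1 / 16) (from-yes (0ℚ ℚ.≤? + 1 / 16)) (ℕP.≰⇒> large)

at-most-one : ∀ {A : Set} (p : A → Bool) {l} → AllPairs _≢_ l → (∀ a b → p a ≡ true → p b ≡ true → a ≡ b) →
              length (filterᵇ p l) ℕ.≤ 1
at-most-one p []                     unique = z≤n
at-most-one p {a ∷ l} (a∉l ∷ l-distinct) unique with p a in pa
... | true  rewrite List.filter-none (T? ∘ p) (All.map (λ a≢b pb → a≢b (unique a _ pa (T⇒≡ pb))) a∉l) = s≤s z≤n
... | false = at-most-one p l-distinct unique

<∣>-keep : ∀ {m n : Maybe ℕ} {v} → m ≡ just v → (m <∣> n) ≡ just v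
<∣>-keep refl = refl

<∣>-fallback : ∀ {m n : Maybe ℕ} → m ≡ nothing → (m <∣> n) ≡ n
<∣>-fallback refl = refl

<∣>-cases : ∀ (m : Maybe ℕ) {n v} → (m <∣> n) ≡ just v → m ≡ just v ⊎ (m ≡ nothing × n ≡ just v)
<∣>-cases (just w) eq = inj₁ eq
<∣>-cases nothing  eq = inj₂ (refl , eq)

nth : List ℕ → ℕ → Maybe ℕ
nth []      _       = nothing
nth (a ∷ l) zero    = just a
nth (a ∷ l) (suc i) = nth l i

nth-∈ : ∀ l i {b} → nth l i ≡ just b → b ∈ l
nth-∈ (a ∷ l) zero    refl = here refl
nth-∈ (a ∷ l) (suc i) eq   = there (nth-∈ l i eq)

∈-nth : ∀ l {b} → b ∈ l → ∃ λ i → i ℕ.< length l × nth l i ≡ just b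
∈-nth (a ∷ l) (here refl) = zero , s≤s z≤n , refl
∈-nth (a ∷ l) (there b∈l) = let (i , i<n , eq) = ∈-nth l b∈l in suc i , s≤s i<n , eq

names : Maybe ℕ → ℕ → Bool
names nothing  v = false
names (just w) v = w ≡ᵇ v

names-just : ∀ v → names (just v) v ≡ true
names-just = ≡ᵇ-refl

names⇒≡ : ∀ m v → names m v ≡ true → m ≡ just v
names⇒≡ (just w) v eq = cong just (ℕP.≡ᵇ⇒≡ w v (≡⇒T eq))

firstSender : List (ℕ × Bool) → Maybe ℕ
firstSender []             = nothing
firstSender ((w , b) ∷ ms) = if b then just w else firstSender ms

received : List (ℕ × Bool) → ℕ → Bool
received []             v = false
received ((w , b) ∷ ms) v = if w ≡ᵇ v then b else received ms v

module _ (f : ℕ → Bool) where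

  tagged : List ℕ → List (ℕ × Bool)
  tagged l = map (λ w → w , f w) l

  firstSender-sound : ∀ l {v} → firstSender (tagged l) ≡ just v → v ∈ l × f v ≡ true
  firstSender-sound (w ∷ l) eq with f w in fw
  firstSender-sound (w ∷ l) refl | true  = here refl , fw
  firstSender-sound (w ∷ l) eq   | false = let (v∈l , fv) = firstSender-sound l eq in there v∈l , fv

  firstSender-complete : ∀ l {v} → v ∈ l → f v ≡ true → ∃ λ w → firstSender (tagged l) ≡ just w
  firstSender-complete (w ∷ l) v∈l fv with f w in fw
  ... | true = w , refl
  firstSender-complete (w ∷ l) (here refl) fv | false = ⊥-elim (false≢true (trans (sym fw) fv))
  firstSender-complete (w ∷ l) (there v∈l) fv | false = firstSender-complete l v∈l fv

  received-sound : ∀ l v → received (tagged l) v ≡ true → f v ≡ true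
  received-sound (w ∷ l) v eq with w ≡ᵇ v in w≡v
  ... | true  = subst (λ u → f u ≡ true) (ℕP.≡ᵇ⇒≡ w v (≡⇒T w≡v)) eq
  ... | false = received-sound l v eq

  received-complete : ∀ l {v} → v ∈ l → f v ≡ true → received (tagged l) v ≡ true
  received-complete (w ∷ l) {v} v∈l fv with w ≡ᵇ v in w≡v
  ... | true  = subst (λ u → f u ≡ true) (sym (ℕP.≡ᵇ⇒≡ w v (≡⇒T w≡v))) fv
  received-complete (w ∷ l) (here refl) fv | false = ⊥-elim (false≢true (trans (sym w≡v) (≡ᵇ-refl w)))
  received-complete (w ∷ l) (there v∈l) fv | false = received-complete l v∈l fv

confirmed : Maybe ℕ → List (ℕ × Bool) → Maybe ℕ
confirmed nothing  ms = nothing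
confirmed (just v) ms = if received ms v then just v else nothing

confirmed-just : ∀ m ms {v} → confirmed m ms ≡ just v → m ≡ just v × received ms v ≡ true
confirmed-just (just w) ms eq with received ms w in rw
confirmed-just (just w) ms refl | true = refl , rw

-- Nodes of colour true propose, the others accept.  Phase k
-- consists of a proposal round, in which every unmatched proposer proposes to its k-th
-- support neighbour and every unmatched acceptor takes the first proposal it receives,
-- and a reply round, in which every matched node signals its partner and an unmatched
-- proposer whose target signals it takes the target as partner.

record Node : Set where
  constructor node
  field
    proposer : Bool
    supp     : List ℕ
    partner  : Maybe ℕ
    phase    : ℕ
    replying : Bool

open Node

target : Node → Maybe ℕ
target s = nth (supp s) (phase s)

-- the message to neighbour w: a proposal, or in a reply round "you are my partner"
signal : Node → ℕ → Bool
signal s w = if replying s then names (partner s) w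
             else proposer s ∧ is-nothing (partner s) ∧ names (target s) w

offer : Node → List (ℕ × Bool) → Maybe ℕ
offer s ms = if replying s then confirmed (target s) ms
             else (if proposer s then nothing else firstSender ms)

-- `step` is opaque so that typechecking never unfolds long executions; the field
-- equations below are its definition.
opaque
  step : Node → List (ℕ × Bool) → Node
  step s ms = node (proposer s) (supp s) (partner s <∣> offer s ms)
                   (if replying s then suc (phase s) else phase s) (not (replying s))

opaque
  unfolding step

  step-proposer : ∀ s ms → proposer (step s ms) ≡ proposer s
  step-proposer s ms = refl

  step-supp : ∀ s ms → supp (step s ms) ≡ supp s
  step-supp s ms = refl

  step-partner : ∀ s ms → partner (step s ms) ≡ (partner s <∣> offer s ms)
  step-partner s ms = refl

  step-proposal : ∀ s ms {k} → replying s ≡ false → phase s ≡ k → replying (step s ms) ≡ true × phase (step s ms) ≡ k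
  step-proposal s ms refl refl = refl , refl

  step-reply : ∀ s ms {k} → replying s ≡ true → phase s ≡ k → replying (step s ms) ≡ false × phase (step s ms) ≡ suc k
  step-reply s ms refl refl = refl , refl

proposalAlgorithm : LocalAlgorithm
proposalAlgorithm = record
  { State = Node
  ; Msg   = Bool
  ; init  = λ _ colour weights → node colour (supportOf weights) nothing 0 false
  ; send  = signal
  ; recv  = step
  ; out   = λ s v → names (partner s) v
  }

-- the algorithm runs twice 16 rounds: 16 phases of two rounds each
twice : ℕ → ℕ
twice zero    = zero
twice (suc k) = suc (suc (twice k))

module Execution (G : Graph) (col : ℕ → Bool) (x : ℕ → ℕ → ℚ) where

  state : ℕ → ℕ → Node
  state = run proposalAlgorithm G col x

  inbox : ℕ → ℕ → List (ℕ × Bool)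
  inbox t u = tagged (λ v → signal (state t v) u) (nbrs G u)

  proposer-run : ∀ t u → proposer (state t u) ≡ col u
  proposer-run zero    u = refl
  proposer-run (suc t) u = trans (step-proposer (state t u) (inbox t u)) (proposer-run t u)

  supp-run : ∀ t u → supp (state t u) ≡ support G x u
  supp-run zero    u = refl
  supp-run (suc t) u = trans (step-supp (state t u) (inbox t u)) (supp-run t u)

  proposal-time : ∀ k u → replying (state (twice k) u) ≡ false × phase (state (twice k) u) ≡ k
  reply-time    : ∀ k u → replying (state (suc (twice k)) u) ≡ true × phase (state (suc (twice k)) u) ≡ k

  proposal-time zero    u = refl , refl
  proposal-time (suc k) u = let (r , p) = reply-time k u in step-reply (state (suc (twice k)) u) _ r p
  reply-time k u = let (r , p) = proposal-time k u in step-proposal (state (twice k) u) _ r p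

  -- partners at the start of phase k, and after its proposal round
  P Q : ℕ → ℕ → Maybe ℕ
  P k u = partner (state (twice k) u)
  Q k u = partner (state (suc (twice k)) u)

  targetAt : ℕ → ℕ → Maybe ℕ
  targetAt k u = nth (support G x u) k

  proposal-offer : ∀ k u → offer (state (twice k) u) (inbox (twice k) u) ≡ (if col u then nothing else firstSender (inbox (twice k) u))
  proposal-offer k u rewrite proj₁ (proposal-time k u) | proposer-run (twice k) u = refl

  reply-offer : ∀ k u → offer (state (suc (twice k)) u) (inbox (suc (twice k)) u) ≡ confirmed (targetAt k u) (inbox (suc (twice k)) u)
  reply-offer k u rewrite proj₁ (reply-time k u) | proj₂ (reply-time k u) | supp-run (suc (twice k)) u = refl

  proposal-round : ∀ k u → Q k u ≡ (P k u <∣> (if col u then nothing else firstSender (inbox (twice k) u)))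
  proposal-round k u = trans (step-partner _ _) (cong (P k u <∣>_) (proposal-offer k u))

  reply-round : ∀ k u → P (suc k) u ≡ (Q k u <∣> confirmed (targetAt k u) (inbox (suc (twice k)) u))
  reply-round k u = trans (step-partner _ _) (cong (Q k u <∣>_) (reply-offer k u))

  proposal-signal : ∀ k v u → signal (state (twice k) v) u ≡ (col v ∧ is-nothing (P k v) ∧ names (targetAt k v) u)
  proposal-signal k v u rewrite proj₁ (proposal-time k v) | proj₂ (proposal-time k v) | proposer-run (twice k) v | supp-run (twice k) v = refl

  reply-signal : ∀ k v u → signal (state (suc (twice k)) v) u ≡ names (Q k v) u
  reply-signal k v u rewrite proj₁ (reply-time k v) = refl

  keep-proposal : ∀ k u {v} → P k u ≡ just v → Q k u ≡ just v
  keep-proposal k u eq = trans (proposal-round k u) (<∣>-keep eq)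

  keep-reply : ∀ k u {v} → Q k u ≡ just v → P (suc k) u ≡ just v
  keep-reply k u eq = trans (reply-round k u) (<∣>-keep eq)

  keep : ∀ k u {v} → P k u ≡ just v → P (suc k) u ≡ just v
  keep k u eq = keep-reply k u (keep-proposal k u eq)

  unmatched-before : ∀ {m n : Maybe ℕ} → (∀ {v} → m ≡ just v → n ≡ just v) → n ≡ nothing → m ≡ nothing
  unmatched-before {nothing} _    _  = refl
  unmatched-before {just v}  keeps eq with () ← trans (sym eq) (keeps refl)

  Proposes : ℕ → ℕ → ℕ → Set
  Proposes k v u = col v ≡ true × P k v ≡ nothing × targetAt k v ≡ just u

  proposes⁻ : ∀ k v u → signal (state (twice k) v) u ≡ true → Proposes k v u
  proposes⁻ k v u sent with col v | P k v | proposal-signal k v u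
  ... | true  | nothing | eq = refl , refl , names⇒≡ _ u (trans (sym eq) sent)
  ... | true  | just _  | eq with () ← trans (sym sent) eq
  ... | false | _       | eq with () ← trans (sym sent) eq

  proposes⁺ : ∀ k v u → Proposes k v u → signal (state (twice k) v) u ≡ true
  proposes⁺ k v u (cv , unmatched , tgt) rewrite proposal-signal k v u | cv | unmatched | tgt = names-just u

  accepted : ∀ k u {v} → P k u ≡ nothing → Q k u ≡ just v → col u ≡ false × v ∈ nbrs G u × Proposes k v u
  accepted k u {v} unmatched matched with col u | trans (sym (proposal-round k u)) matched
  ... | false | eq rewrite unmatched =
    let (v∈N , sent) = firstSender-sound (λ w → signal (state (twice k) w) u) (nbrs G u) eq
    in refl , v∈N , proposes⁻ k v u sent
  ... | true  | eq rewrite unmatched with () ← eq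

module Correctness (G : Graph) (col : ℕ → Bool) (coloured : Proper2Coloring G col) (x : ℕ → ℕ → ℚ) where

  open Execution G col x

  opposite : ∀ {u v} → u ∈ V G → v ∈ V G → adj G u v ≡ true → col v ≡ not (col u)
  opposite u∈V v∈V uv = ¬-not (λ eq → coloured _ _ u∈V v∈V uv (sym eq))

  support-nbr : ∀ {u v} → v ∈ support G x u → v ∈ V G × adj G u v ≡ true
  support-nbr v∈S = ∈-nbrs⁻ G (proj₁ (∈-support⁻ G x v∈S))

  accepted-mutual : ∀ k u v → u ∈ V G → P k u ≡ nothing → Q k u ≡ just v →
                    v ∈ V G × adj G u v ≡ true × P (suc k) v ≡ just u
  accepted-mutual k u v u∈V unmatched matched with accepted k u unmatched matched
  ... | _ , v∈N , (v-proposer , v-unmatched , v-target) = v∈V , uv , v-matched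
    where
    v∈V = proj₁ (∈-nbrs⁻ G v∈N)
    uv  = proj₂ (∈-nbrs⁻ G v∈N)
    v-still-unmatched : Q k v ≡ nothing
    v-still-unmatched rewrite proposal-round k v | v-unmatched | v-proposer = refl
    u-signals : signal (state (suc (twice k)) u) v ≡ true
    u-signals rewrite reply-signal k u v | matched = names-just v
    heard : received (inbox (suc (twice k)) v) u ≡ true
    heard = received-complete (λ w → signal (state (suc (twice k)) w) v) (nbrs G v)
              (∈-nbrs⁺ G u∈V (trans (adj-sym G v u) uv)) u-signals
    v-matched : P (suc k) v ≡ just u
    v-matched rewrite reply-round k v | v-still-unmatched | v-target | heard = refl

  confirmed-mutual : ∀ k u v → Q k u ≡ nothing → P (suc k) u ≡ just v →
                     v ∈ V G × adj G u v ≡ true × P (suc k) v ≡ just u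
  confirmed-mutual k u v unmatched matched
    with confirmed-just (targetAt k u) (inbox (suc (twice k)) u)
           (trans (sym (<∣>-fallback unmatched)) (trans (sym (reply-round k u)) matched))
  ... | v-target , heard = v∈V , uv , keep-reply k v (names⇒≡ (Q k v) u v-signals)
    where
    v∈V = proj₁ (support-nbr (nth-∈ (support G x u) k v-target))
    uv  = proj₂ (support-nbr (nth-∈ (support G x u) k v-target))
    v-signals : names (Q k v) u ≡ true
    v-signals = trans (sym (reply-signal k v u))
                  (received-sound (λ w → signal (state (suc (twice k)) w) u) (nbrs G u) v heard)

  Mutual : ℕ → Set
  Mutual k = ∀ u v → u ∈ V G → P k u ≡ just v → v ∈ V G × adj G u v ≡ true × P k v ≡ just u

  partners-mutual : ∀ k → Mutual k
  partners-mutual zero    u v u∈V ()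
  partners-mutual (suc k) u v u∈V matched with <∣>-cases (Q k u) (trans (sym (reply-round k u)) matched)
  ... | inj₂ (Q-unmatched , _) = confirmed-mutual k u v Q-unmatched matched
  ... | inj₁ Q-matched with <∣>-cases (P k u) (trans (sym (proposal-round k u)) Q-matched)
  ...   | inj₂ (P-unmatched , _) = accepted-mutual k u v u∈V P-unmatched Q-matched
  ...   | inj₁ P-matched = let (v∈V , uv , back) = partners-mutual k u v u∈V P-matched in v∈V , uv , keep k v back

  Matched : ℕ → ℕ → Set
  Matched k u = ∃ λ c → P k u ≡ just c

  status : ∀ k u → Matched k u ⊎ P k u ≡ nothing
  status k u with P k u
  ... | just c  = inj₁ (c , refl)
  ... | nothing = inj₂ refl

  answered : ∀ k w b → w ∈ V G → b ∈ V G → adj G w b ≡ true → Proposes k w b → Matched (suc k) b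
  answered k w b w∈V b∈V wb proposal@(w-proposer , _ , _) with status k b
  ... | inj₁ (c , b-partner) = c , keep k b b-partner
  ... | inj₂ b-partner with firstSender-complete (λ v → signal (state (twice k) v) b) (nbrs G b)
                       (∈-nbrs⁺ G w∈V (trans (adj-sym G b w) wb)) (proposes⁺ k w b proposal)
  ...   | c , first = c , keep-reply k b b-accepts
    where
    b-acceptor : col b ≡ false
    b-acceptor = trans (opposite w∈V b∈V wb) (cong not w-proposer)
    b-accepts : Q k b ≡ just c
    b-accepts rewrite proposal-round k b | b-partner | b-acceptor = first

  -- an unmatched proposer has proposed to all its first k support neighbours, and all of them are matched
  Exhausted : ℕ → Set
  Exhausted k = ∀ w i b → w ∈ V G → col w ≡ true → P k w ≡ nothing → i ℕ.< k → targetAt i w ≡ just b → Matched k b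

  exhausted : ∀ k → Exhausted k
  exhausted zero    w i b w∈V w-proposer unmatched ()
  exhausted (suc k) w i b w∈V w-proposer unmatched i<k+1 target
    with unmatched-before (keep k w) unmatched | ℕP.m<1+n⇒m<n∨m≡n i<k+1
  ... | unmatched-before-k | inj₁ i<k =
    let (c , matched) = exhausted k w i b w∈V w-proposer unmatched-before-k i<k target in c , keep k b matched
  ... | unmatched-before-k | inj₂ refl =
    let (b∈V , wb) = support-nbr (nth-∈ (support G x w) i target) in
    answered i w b w∈V b∈V wb (w-proposer , unmatched-before-k , target)

  rounds : ℕ
  rounds = twice 16

  Out : ℕ → ℕ → Bool
  Out = output proposalAlgorithm G col x rounds

  Out⁻ : ∀ u v → Out u v ≡ true → adj G u v ≡ true × P 16 u ≡ just v
  Out⁻ u v sel = ∧-conicalˡ (adj G u v) (names (P 16 u) v) sel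
               , names⇒≡ (P 16 u) v (∧-conicalʳ (adj G u v) (names (P 16 u) v) sel)

  Out-partner : ∀ u v → u ∈ V G → P 16 u ≡ just v → Out u v ≡ true
  Out-partner u v u∈V partnered =
    let (_ , uv , _) = partners-mutual 16 u v u∈V partnered
    in trans (cong₂ _∧_ uv (cong (λ m → names m v) partnered)) (names-just v)

  Out-flip : ∀ u v → u ∈ V G → Out u v ≡ true → Out v u ≡ true
  Out-flip u v u∈V sel =
    let (v∈V , _ , back) = partners-mutual 16 u v u∈V (proj₂ (Out⁻ u v sel)) in Out-partner v u v∈V back

  Out-symmetric : ∀ u v → u ∈ V G → v ∈ V G → Out u v ≡ Out v u
  Out-symmetric u v u∈V v∈V = ⇔→≡ {z = true} (mk⇔ (Out-flip u v u∈V) (Out-flip v u v∈V))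

  Out-consistent : Consistent G Out
  Out-consistent u v u∈V v∈V _ = Out-symmetric u v u∈V v∈V

  -- u selects at most one neighbour: neighbours are distinct and every selected one is u's partner
  Out-degree : ∀ u → length (filterᵇ (Out u) (nbrs G u)) ℕ.≤ 1
  Out-degree u = at-most-one (Out u) distinct same-partner
    where
    distinct : AllPairs _≢_ (nbrs G u)
    distinct = AllPairs.filter⁺ (T? ∘ adj G u) (AllPairs.map ℕP.<⇒≢ (V-ids G))
    same-partner : ∀ v w → Out u v ≡ true → Out u w ≡ true → v ≡ w
    same-partner v w sv sw = just-injective (trans (sym (proj₂ (Out⁻ u v sv))) (proj₂ (Out⁻ u w sw)))

  Out-matching : IntegralMatching G Out
  Out-matching = record
    { onEdges = λ u v _ _ sel → proj₁ (Out⁻ u v sel)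
    ; symm    = Out-symmetric
    ; vertex  = λ u _ → Out-degree u
    }

  partner-matched : ∀ u c → u ∈ V G → P 16 u ≡ just c → matched G Out u ≡ true
  partner-matched u c u∈V partnered =
    let (c∈V , uc , _) = partners-mutual 16 u c u∈V partnered
    in matched-intro G Out (∈-nbrs⁺ G c∈V uc) (Out-partner u c u∈V partnered)

  module _ (fm : FractionalMatching G x) (dyadic : DyadicFractional 4 G x) where

    -- a support edge at a proposer has a matched endpoint: the proposer, or else the edge was proposed along
    proposer-covers : ∀ {w b} → w ∈ V G → b ∈ V G → col w ≡ true → b ∈ support G x w →
                      matched G Out w ≡ true ⊎ matched G Out b ≡ true
    proposer-covers {w} {b} w∈V b∈V w-proposer b∈S = Sum.map partnered-w partnered-b (status 16 w)
      where
      partnered-w : Matched 16 w → matched G Out w ≡ true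
      partnered-w (c , partnered) = partner-matched w c w∈V partnered
      partnered-b : P 16 w ≡ nothing → matched G Out b ≡ true
      partnered-b unmatched =
        let (i , i<len , target) = ∈-nth (support G x w) b∈S
            early = ℕP.<-≤-trans i<len (support-size fm dyadic w w∈V)
            (c , partnered) = exhausted 16 w i b w∈V w-proposer unmatched early target
        in partner-matched b c b∈V partnered

    -- the output covers the support: every support edge has a proposer endpoint
    Out-covers : CoversSupport G Out x
    Out-covers u v u∈V v∈V uv x≢0 = by-colour (col u) refl
      where
      vu = trans (adj-sym G v u) uv
      by-colour : ∀ b → col u ≡ b → matched G Out u ≡ true ⊎ matched G Out v ≡ true
      by-colour true  u-proposer = proposer-covers u∈V v∈V u-proposer (∈-support⁺ G x (∈-nbrs⁺ G v∈V uv) x≢0)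
      by-colour false u-acceptor = Sum.swap (proposer-covers v∈V u∈V v-proposer (∈-support⁺ G x (∈-nbrs⁺ G u∈V vu) xvu≢0))
        where
        v-proposer : col v ≡ true
        v-proposer = trans (opposite u∈V v∈V uv) (cong not u-acceptor)
        xvu≢0 : x v u ≢ 0ℚ
        xvu≢0 = x≢0 ∘ trans (FractionalMatching.symm fm u v u∈V v∈V uv)

lemma4p7 : Σ LocalAlgorithm λ A → Σ ℕ λ T →
    (G : Graph) (col : ℕ → Bool) → Proper2Coloring G col →
    (x : ℕ → ℕ → ℚ) → FractionalMatching G x → DyadicFractional 4 G x →
    Approximate (+ 14 / 1) G x →
    Consistent G (output A G col x T)
    × IntegralMatching G (output A G col x T)
    × Approximate (+ 434 / 1) G (indicator (output A G col x T))
lemma4p7 = proposalAlgorithm , twice 16 , λ G col coloured x fm dyadic fourteen-approx →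
  let open Correctness G col coloured x
      half-weight = cover-weight fm Out Out-consistent (Out-covers fm dyadic)
  in Out-consistent , Out-matching ,
     approximate-half (+ 14 / 1) (+ 434 / 1) G x (indicator Out) (from-yes (+ 14 / 1 + + 14 / 1 ℚ.≤? + 434 / 1))
                      (indicator-weight-nonneg G Out) half-weight fourteen-approx
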